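{- For all PDL programs $\alpha$ and all PDL formulas $\psi$, \[ \lnot[\alpha]\psi \equiv \bigvee\Big\{\textstyle\bigwedge X\land\lnot\Box(\bar\delta,\psi) \;\Big|\; (X,\bar\delta)\in H_\alpha\Big\}. \]
   Context: PDL syntax $\phi ::= \bot \mid p \mid \lnot\phi \mid \phi\land\phi \mid [\alpha]\phi$, $\alpha ::= a \mid \tau? \mid \alpha\cup\beta \mid \alpha;\beta \mid \alpha^\ast$ with standard Kripke semantics; $\equiv$ is semantic equivalence; $\bigwedge X$ is the conjunction of a finite set ($\top$ if empty). For a list $\bar\delta=\delta_1\cdots\delta_n$ of programs, $\Box(\bar\delta,\phi)=[\delta_1]\cdots[\delta_n]\phi$, with $\Box(\varepsilon,\phi)=\phi$; juxtaposition is concatenation. $H_\alpha$ is a set of pairs $(X,\bar\delta)$ ($X$ a finite set of formulas, $\bar\delta$ a list of programs) defined by: $H_a=\{(\emptyset,a)\}$; $H_{\tau?}=\{(\{\tau\},\varepsilon)\}$; $H_{\alpha\cup\beta}=H_\alpha\cup H_\beta$; $H_{\alpha;\beta}=\{(X,\bar\delta\beta)\mid(X,\bar\delta)\in H_\alpha,\bar\delta\neq\varepsilon\}\cup\{(X\cup Y,\bar\delta)\mid(X,\varepsilon)\in H_\alpha,(Y,\bar\delta)\in H_\beta\}$; $H_{\alpha^\ast}=\{(\emptyset,\varepsilon)\}\cup\{(X,\bar\delta\alpha^\ast)\mid(X,\bar\delta)\in H_\alpha,\bar\delta\neq\varepsilon\}$. -}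

module Defs where

open import Data.Nat using (ℕ)
open import Data.List using (List; []; _∷_; _++_; concatMap)
open import Data.Product using (_×_; _,_; Σ)
open import Data.Empty using (⊥)
open import Data.Sum using (_⊎_)
open import Relation.Binary.PropositionalEquality using (_≡_)
open import Relation.Binary.Construct.Closure.ReflexiveTransitive using (Star)
open import Function.Bundles using (_⇔_)

mutual
  data Form : Set where
    ⊥ᶠ   : Form
    var  : ℕ → Form
    ¬ᶠ_  : Form → Form
    _∧ᶠ_ : Form → Form → Form
    [_]_ : Prog → Form → Form

  data Prog : Set where
    atom : ℕ → Prog
    _¿   : Form → Prog
    _∪ᵖ_ : Prog → Prog → Prog
    _⨾_  : Prog → Prog → Prog
    _*   : Prog → Prog

⊤ᶠ : Form
⊤ᶠ = ¬ᶠ ⊥ᶠ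

_∨ᶠ_ : Form → Form → Form
φ ∨ᶠ ψ = ¬ᶠ ((¬ᶠ φ) ∧ᶠ (¬ᶠ ψ))

⋀ : List Form → Form
⋀ []       = ⊤ᶠ
⋀ (φ ∷ φs) = φ ∧ᶠ ⋀ φs

⋁ : List Form → Form
⋁ []       = ⊥ᶠ
⋁ (φ ∷ φs) = φ ∨ᶠ ⋁ φs

Box : List Prog → Form → Form
Box []       φ = φ
Box (δ ∷ δs) φ = [ δ ] Box δs φ

HPair : Set
HPair = List Form × List Prog

appendNonEmpty : Prog → List HPair → List HPair
appendNonEmpty β []                  = []
appendNonEmpty β ((X , []) ∷ h)      = appendNonEmpty β h
appendNonEmpty β ((X , δ ∷ δs) ∷ h) = (X , (δ ∷ δs) ++ (β ∷ [])) ∷ appendNonEmpty β h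

-- { (X ∪ Y, δ̄) | (X, ε) ∈ H₁, (Y, δ̄) ∈ H₂ }
combineEmpty : List HPair → List HPair → List HPair
combineEmpty []                 h₂ = []
combineEmpty ((X , []) ∷ h₁)    h₂ =
  concatMap (λ { (Y , δs) → (X ++ Y , δs) ∷ [] }) h₂ ++ combineEmpty h₁ h₂
combineEmpty ((X , _ ∷ _) ∷ h₁) h₂ = combineEmpty h₁ h₂

H : Prog → List HPair
H (atom a)  = ([] , atom a ∷ []) ∷ []
H (τ ¿)     = (τ ∷ [] , []) ∷ []
H (α ∪ᵖ β)  = H α ++ H β
H (α ⨾ β)   = appendNonEmpty β (H α) ++ combineEmpty (H α) (H β)
H (α *)     = ([] , []) ∷ appendNonEmpty (α *) (H α)

record Model : Set₁ where
  field
    W : Set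
    R : ℕ → W → W → Set
    V : ℕ → W → Set
open Model public

mutual
  _,_⊨_ : (M : Model) → W M → Form → Set
  M , w ⊨ ⊥ᶠ      = ⊥
  M , w ⊨ var p   = V M p w
  M , w ⊨ (¬ᶠ φ)  = M , w ⊨ φ → ⊥
  M , w ⊨ (φ ∧ᶠ ψ) = (M , w ⊨ φ) × (M , w ⊨ ψ)
  M , w ⊨ ([ α ] φ) = (v : W M) → ⟦ M ∣ α ⟧ w v → M , v ⊨ φ

  ⟦_∣_⟧ : (M : Model) → Prog → W M → W M → Set
  ⟦ M ∣ atom a ⟧ w v  = R M a w v
  ⟦ M ∣ τ ¿ ⟧ w v     = (w ≡ v) × (M , w ⊨ τ)
  ⟦ M ∣ α ∪ᵖ β ⟧ w v  = ⟦ M ∣ α ⟧ w v ⊎ ⟦ M ∣ β ⟧ w v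
  ⟦ M ∣ α ⨾ β ⟧ w v   = Σ (W M) (λ u → ⟦ M ∣ α ⟧ w u × ⟦ M ∣ β ⟧ u v)
  ⟦ M ∣ α * ⟧ w v     = Star ⟦ M ∣ α ⟧ w v

_≡ˢ_ : Form → Form → Set₁
φ ≡ˢ ψ = (M : Model) (w : W M) → (M , w ⊨ φ) ⇔ (M , w ⊨ ψ)

disjunct : Form → HPair → Form
disjunct ψ (X , δs) = ⋀ X ∧ᶠ (¬ᶠ Box δs ψ)

-- Unfolding the semantics, ⟦α⟧ w u holds iff some (X, δ̄) ∈ H α has X true at w and a
-- δ̄-path from w to u. For α;β and α* this splits on whether the first α-part moves (the
-- pairs built by appendNonEmpty) or only tests at w (the pairs built by combineEmpty; in
-- α* such a pure-test iteration is a loop at w and is dropped). Hence [α]ψ is equivalent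
-- to ⋀{⋀X → Box(δ̄,ψ) | (X, δ̄) ∈ H α}. The semantics is constructive, but both sides of
-- the theorem are negations, and under ¬ both ¬(A → B) ⇔ ¬¬(A ∧ ¬B) and the
-- distribution of ¬¬ over a finite conjunction are valid.
module Submission where

open import Data.Empty using (⊥; ⊥-elim)
open import Data.List using (List; []; _∷_; _++_; _∷ʳ_; map)
open import Data.List.Relation.Unary.All as All using (All; []; _∷_)
open import Data.List.Relation.Unary.Any as Any using (Any; here; there)
open import Data.List.Relation.Unary.Any.Properties using (++⁺ˡ; ++⁺ʳ; ++⁻; concatMap⁺; concatMap⁻; singleton⁻)
open import Data.Product using (_×_; _,_; ∃-syntax; proj₁; proj₂; map₁)
open import Data.Sum using (_⊎_; inj₁; inj₂)
open import Function using (_∘_; id)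
open import Function.Bundles using (_⇔_; mk⇔; Equivalence)
open import Function.Properties.Equivalence using (⇔-setoid)
open import Function.Related.TypeIsomorphisms using (¬-cong-⇔)
open import Level using (0ℓ)
open import Relation.Binary.Construct.Closure.ReflexiveTransitive using (ε; _◅_)
open import Relation.Binary.PropositionalEquality using (_≡_; refl)
import Relation.Binary.Reasoning.Setoid
open import Relation.Nullary.Negation using (¬_; ¬¬-Monad)

open import Defs

¬All-cong-¬¬ : ∀ {A : Set} {P Q : A → Set} {xs : List A} →
               (∀ {x} → P x → Q x) → (∀ {x} → Q x → ¬ ¬ P x) →
               (¬ All P xs) ⇔ (¬ All Q xs)
¬All-cong-¬¬ P⇒Q Q⇒¬¬P =
  mk⇔ (λ ¬allP allQ → All.sequenceM 0ℓ ¬¬-Monad (All.map Q⇒¬¬P allQ) ¬allP)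
      (λ ¬allQ → ¬allQ ∘ All.map P⇒Q)

→⇒¬×¬ : ∀ {A B : Set} → (A → B) → ¬ (A × ¬ B)
→⇒¬×¬ f (a , ¬b) = ¬b (f a)

¬×¬⇒¬¬→ : ∀ {A B : Set} → ¬ (A × ¬ B) → ¬ ¬ (A → B)
¬×¬⇒¬¬→ h ¬f = ¬f (λ a → ⊥-elim (h (a , λ b → ¬f (λ _ → b))))

Any-×ˡ⁻ : ∀ {A B : Set} {P : B → Set} {xs : List B} → Any (λ x → A × P x) xs → A × Any P xs
Any-×ˡ⁻ ρ = proj₁ (proj₂ (Any.satisfied ρ)) , Any.map proj₂ ρ

module _ (M : Model) where

  Path : List Prog → W M → W M → Set
  Path []       w u = w ≡ u
  Path (δ ∷ δs) w u = ∃[ v ] ⟦ M ∣ δ ⟧ w v × Path δs v u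

  Path-∷ʳ⁺ : ∀ δs {β w v u} → Path δs w v → ⟦ M ∣ β ⟧ v u → Path (δs ∷ʳ β) w u
  Path-∷ʳ⁺ []       {u = u} refl r = u , r , refl
  Path-∷ʳ⁺ (δ ∷ δs) (v , r , p) r′ = v , r , Path-∷ʳ⁺ δs p r′

  Path-∷ʳ⁻ : ∀ δs {β w u} → Path (δs ∷ʳ β) w u → ∃[ v ] Path δs w v × ⟦ M ∣ β ⟧ v u
  Path-∷ʳ⁻ []       {w = w} (u , r , refl) = w , refl , r
  Path-∷ʳ⁻ (δ ∷ δs) (v , r , p) with Path-∷ʳ⁻ δs p
  ... | v′ , p′ , r′ = v′ , (v , r , p′) , r′

  ⊨Box⁺ : ∀ δs {ψ w} → (∀ {u} → Path δs w u → M , u ⊨ ψ) → M , w ⊨ Box δs ψ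
  ⊨Box⁺ []       f = f refl
  ⊨Box⁺ (δ ∷ δs) f v r = ⊨Box⁺ δs (λ p → f (v , r , p))

  ⊨Box⁻ : ∀ δs {ψ w u} → M , w ⊨ Box δs ψ → Path δs w u → M , u ⊨ ψ
  ⊨Box⁻ []       b refl        = b
  ⊨Box⁻ (δ ∷ δs) b (v , r , p) = ⊨Box⁻ δs (b v r) p

  ⊨⋀-++⁺ : ∀ X {Y w} → M , w ⊨ ⋀ X → M , w ⊨ ⋀ Y → M , w ⊨ ⋀ (X ++ Y)
  ⊨⋀-++⁺ []      _       y = y
  ⊨⋀-++⁺ (_ ∷ X) (p , x) y = p , ⊨⋀-++⁺ X x y

  ⊨⋀-++⁻ : ∀ X {Y w} → M , w ⊨ ⋀ (X ++ Y) → (M , w ⊨ ⋀ X) × (M , w ⊨ ⋀ Y)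
  ⊨⋀-++⁻ []      y        = id , y
  ⊨⋀-++⁻ (_ ∷ X) (p , xy) with ⊨⋀-++⁻ X xy
  ... | x , y = (p , x) , y

  ⊨⋁⇔¬All¬ : ∀ {A : Set} (f : A → Form) xs {w} →
             (M , w ⊨ ⋁ (map f xs)) ⇔ (¬ All (λ x → ¬ (M , w ⊨ f x)) xs)
  ⊨⋁⇔¬All¬ f xs = mk⇔ (to xs) (from xs)
    where
    to : ∀ xs {w} → M , w ⊨ ⋁ (map f xs) → ¬ All (λ x → ¬ (M , w ⊨ f x)) xs
    to []       ()
    to (_ ∷ xs) h (¬fx ∷ all) = h (¬fx , λ o → to xs o all)

    from : ∀ xs {w} → ¬ All (λ x → ¬ (M , w ⊨ f x)) xs → M , w ⊨ ⋁ (map f xs)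
    from []       k               = k []
    from (_ ∷ xs) k (¬fx , ¬rest) = ¬rest (from xs (λ all → k (¬fx ∷ all)))

  Route : W M → W M → HPair → Set
  Route w u (X , δs) = (M , w ⊨ ⋀ X) × Path δs w u

  Route⁺ : W M → W M → HPair → Set
  Route⁺ w u (_ , [])     = ⊥
  Route⁺ w u (X , δ ∷ δs) = Route w u (X , δ ∷ δs)

  Route⁰ : W M → HPair → Set
  Route⁰ w (X , [])    = M , w ⊨ ⋀ X
  Route⁰ w (_ , _ ∷ _) = ⊥

  Route-prefix⁺ : ∀ X {w u e} → M , w ⊨ ⋀ X → Route w u e → Route w u (X ++ proj₁ e , proj₂ e)
  Route-prefix⁺ X x (y , p) = ⊨⋀-++⁺ X x y , p

  Route-prefix⁻ : ∀ X {w u e} → Route w u (X ++ proj₁ e , proj₂ e) → (M , w ⊨ ⋀ X) × Route w u e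
  Route-prefix⁻ X (xy , p) = let x , y = ⊨⋀-++⁻ X xy in x , y , p

  Route⁺⇒Route : ∀ {w u e} → Route⁺ w u e → Route w u e
  Route⁺⇒Route {e = _ , _ ∷ _} ρ = ρ

  Route⁰⇒Route : ∀ {w e} → Route⁰ w e → Route w w e
  Route⁰⇒Route {e = _ , []} x = x , refl

  Any-Route-split : ∀ h {w u} → Any (Route w u) h →
                    Any (Route⁺ w u) h ⊎ (w ≡ u × Any (Route⁰ w) h)
  Any-Route-split ((_ , [])    ∷ _) (here (x , refl)) = inj₂ (refl , here x)
  Any-Route-split ((_ , _ ∷ _) ∷ _) (here ρ)          = inj₁ (here ρ)
  Any-Route-split (_ ∷ h) (there ρs) with Any-Route-split h ρs
  ... | inj₁ steps         = inj₁ (there steps)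
  ... | inj₂ (w≡u , tests) = inj₂ (w≡u , there tests)

  appendNonEmpty⁺ : ∀ β h {w v u} → Any (Route⁺ w v) h → ⟦ M ∣ β ⟧ v u →
                    Any (Route w u) (appendNonEmpty β h)
  appendNonEmpty⁺ β ((_ , [])     ∷ h) (there ρs)     r = appendNonEmpty⁺ β h ρs r
  appendNonEmpty⁺ β ((_ , δ ∷ δs) ∷ h) (here (x , p)) r = here (x , Path-∷ʳ⁺ (δ ∷ δs) p r)
  appendNonEmpty⁺ β ((_ , _ ∷ _)  ∷ h) (there ρs)     r = there (appendNonEmpty⁺ β h ρs r)

  appendNonEmpty⁻ : ∀ β h {w u} → Any (Route w u) (appendNonEmpty β h) →
                    ∃[ v ] Any (Route⁺ w v) h × ⟦ M ∣ β ⟧ v u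
  appendNonEmpty⁻ β ((_ , []) ∷ h) ρs with appendNonEmpty⁻ β h ρs
  ... | v , steps , r = v , there steps , r
  appendNonEmpty⁻ β ((_ , δ ∷ δs) ∷ h) (here (x , p)) with Path-∷ʳ⁻ (δ ∷ δs) p
  ... | v , p′ , r = v , here (x , p′) , r
  appendNonEmpty⁻ β ((_ , _ ∷ _) ∷ h) (there ρs) with appendNonEmpty⁻ β h ρs
  ... | v , steps , r = v , there steps , r

  combineEmpty⁺ : ∀ h₁ h₂ {w u} → Any (Route⁰ w) h₁ → Any (Route w u) h₂ →
                  Any (Route w u) (combineEmpty h₁ h₂)
  combineEmpty⁺ ((X , [])    ∷ h₁) h₂ (here x) ρs =
    ++⁺ˡ (concatMap⁺ _ (Any.map (here ∘ Route-prefix⁺ X x) ρs))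
  combineEmpty⁺ ((_ , [])    ∷ h₁) h₂ (there tests) ρs = ++⁺ʳ _ (combineEmpty⁺ h₁ h₂ tests ρs)
  combineEmpty⁺ ((_ , _ ∷ _) ∷ h₁) h₂ (there tests) ρs = combineEmpty⁺ h₁ h₂ tests ρs

  combineEmpty⁻ : ∀ h₁ h₂ {w u} → Any (Route w u) (combineEmpty h₁ h₂) →
                  Any (Route⁰ w) h₁ × Any (Route w u) h₂
  combineEmpty⁻ ((X , []) ∷ h₁) h₂ ρs with ++⁻ _ ρs
  ... | inj₁ ρs′ =
    map₁ here (Any-×ˡ⁻ (Any.map (Route-prefix⁻ X ∘ singleton⁻) (concatMap⁻ _ ρs′)))
  ... | inj₂ ρs′ = map₁ there (combineEmpty⁻ h₁ h₂ ρs′)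
  combineEmpty⁻ ((_ , _ ∷ _) ∷ h₁) h₂ ρs = map₁ there (combineEmpty⁻ h₁ h₂ ρs)

  Any-Route⇒⟦⟧ : ∀ α {w u} → Any (Route w u) (H α) → ⟦ M ∣ α ⟧ w u
  Any-Route⇒⟦⟧ (atom _) (here (_ , v , r , refl)) = r
  Any-Route⇒⟦⟧ (τ ¿)    (here ((t , _) , refl))   = refl , t
  Any-Route⇒⟦⟧ (α ∪ᵖ β) ρs with ++⁻ (H α) ρs
  ... | inj₁ ρs′ = inj₁ (Any-Route⇒⟦⟧ α ρs′)
  ... | inj₂ ρs′ = inj₂ (Any-Route⇒⟦⟧ β ρs′)
  Any-Route⇒⟦⟧ (α ⨾ β) {w} ρs with ++⁻ (appendNonEmpty β (H α)) ρs
  ... | inj₁ ρs′ = let v , steps , r = appendNonEmpty⁻ β (H α) ρs′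
                   in v , Any-Route⇒⟦⟧ α (Any.map Route⁺⇒Route steps) , r
  ... | inj₂ ρs′ = let tests , ρs″ = combineEmpty⁻ (H α) (H β) ρs′
                   in w , Any-Route⇒⟦⟧ α (Any.map Route⁰⇒Route tests) , Any-Route⇒⟦⟧ β ρs″
  Any-Route⇒⟦⟧ (α *) (here (_ , refl)) = ε
  Any-Route⇒⟦⟧ (α *) (there ρs) =
    let v , steps , rs = appendNonEmpty⁻ (α *) (H α) ρs
    in Any-Route⇒⟦⟧ α (Any.map Route⁺⇒Route steps) ◅ rs

  ⟦⟧⇒Any-Route : ∀ α {w u} → ⟦ M ∣ α ⟧ w u → Any (Route w u) (H α)
  ⟦⟧⇒Any-Route (atom _) {u = u} r = here (id , u , r , refl)
  ⟦⟧⇒Any-Route (τ ¿) (refl , t)    = here ((t , id) , refl)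
  ⟦⟧⇒Any-Route (α ∪ᵖ β) (inj₁ r)   = ++⁺ˡ (⟦⟧⇒Any-Route α r)
  ⟦⟧⇒Any-Route (α ∪ᵖ β) (inj₂ r)   = ++⁺ʳ (H α) (⟦⟧⇒Any-Route β r)
  ⟦⟧⇒Any-Route (α ⨾ β) (v , r , r′) with Any-Route-split (H α) (⟦⟧⇒Any-Route α r)
  ... | inj₁ steps          = ++⁺ˡ (appendNonEmpty⁺ β (H α) steps r′)
  ... | inj₂ (refl , tests) = ++⁺ʳ _ (combineEmpty⁺ (H α) (H β) tests (⟦⟧⇒Any-Route β r′))
  ⟦⟧⇒Any-Route (α *) ε = here (id , refl)
  ⟦⟧⇒Any-Route (α *) (r ◅ rs) with Any-Route-split (H α) (⟦⟧⇒Any-Route α r)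
  ... | inj₁ steps      = there (appendNonEmpty⁺ (α *) (H α) steps rs)
  ... | inj₂ (refl , _) = ⟦⟧⇒Any-Route (α *) rs

  Guarded : Form → W M → HPair → Set
  Guarded ψ w e = M , w ⊨ ⋀ (proj₁ e) → M , w ⊨ Box (proj₂ e) ψ

  All-Guarded⇔ : ∀ h {ψ w} → All (Guarded ψ w) h ⇔ (∀ u → Any (Route w u) h → M , u ⊨ ψ)
  All-Guarded⇔ h = mk⇔ (to h) (from h)
    where
    to : ∀ h {ψ w} → All (Guarded ψ w) h → ∀ u → Any (Route w u) h → M , u ⊨ ψ
    to ((_ , δs) ∷ _) (g ∷ _)  u (here (x , p)) = ⊨Box⁻ δs (g x) p
    to (_ ∷ h)        (_ ∷ gs) u (there ρs)     = to h gs u ρs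

    from : ∀ h {ψ w} → (∀ u → Any (Route w u) h → M , u ⊨ ψ) → All (Guarded ψ w) h
    from []             f = []
    from ((_ , δs) ∷ h) f = (λ x → ⊨Box⁺ δs (λ p → f _ (here (x , p)))) ∷ from h (λ u → f u ∘ there)

  ⊨[]⇔All-Guarded : ∀ α ψ {w} → (M , w ⊨ ([ α ] ψ)) ⇔ All (Guarded ψ w) (H α)
  ⊨[]⇔All-Guarded α ψ =
    mk⇔ (λ box → Equivalence.from (All-Guarded⇔ (H α)) (λ u → box u ∘ Any-Route⇒⟦⟧ α))
        (λ gs u → Equivalence.to (All-Guarded⇔ (H α)) gs u ∘ ⟦⟧⇒Any-Route α)

lemma3p23 : (α : Prog) (ψ : Form) →
    (¬ᶠ ([ α ] ψ)) ≡ˢ ⋁ (map (disjunct ψ) (H α))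
lemma3p23 α ψ M w = begin
  (M , w ⊨ (¬ᶠ ([ α ] ψ)))                       ≈⟨ ¬-cong-⇔ (⊨[]⇔All-Guarded M α ψ) ⟩
  ¬ All (Guarded M ψ w) (H α)                    ≈⟨ ¬All-cong-¬¬ →⇒¬×¬ ¬×¬⇒¬¬→ ⟩
  ¬ All (λ e → ¬ (M , w ⊨ disjunct ψ e)) (H α)  ≈⟨ ⊨⋁⇔¬All¬ M (disjunct ψ) (H α) ⟨
  (M , w ⊨ ⋁ (map (disjunct ψ) (H α)))           ∎
  where open Relation.Binary.Reasoning.Setoid (⇔-setoid 0ℓ)
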